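{- Let $(u,v)\in\overline{P}$ with $uv\neq ab$, and write $uv=v_au^b=a\theta b$ where $\theta$ is a palindromic word over $\{a,b\}$. Consider any factorization of the bi-infinite word $(uv)^\infty=\cdots uvuv\cdots$ either of the form $(uv)^\infty=y^Tb|ax$ at a position different from a boundary $\cdots uv|uv\cdots$ between consecutive periods, or of the form $(uv)^\infty=x^Ta|by$ at a position different from a boundary $\cdots v_a|u^b\cdots$ (using the decomposition $uv=v_au^b$), where $x,y$ are right infinite words over $\{a,b\}$. Then: (1) if $\theta_1$ is the longest common prefix of $x$ and $\theta$, then $\theta_1b$ is a prefix of $x$ and $\theta_1a$ is a prefix of $\theta$; (2) if $\theta_2$ is the longest common prefix of $y$ and $\theta$, then $\theta_2a$ is a prefix of $y$ and $\theta_2b$ is a prefix of $\theta$.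
   Context: Words are over the two-letter alphabet $\{a,b\}$. $\overline{P}$ is the set of pairs obtained from $(a,b)$ by finitely many (possibly zero) applications of $(\alpha,\beta)\mapsto(\alpha\beta,\beta)$ and $(\alpha,\beta)\mapsto(\alpha,\alpha\beta)$; for $(u,v)\in\overline{P}$, $u$ begins with $a$ and $v$ ends with $b$. For a finite word $w$: $w^T$ is its reversal; $w^b$ is $w$ with its first letter replaced by $b$; $w_a$ is $w$ with its last letter replaced by $a$. For a right infinite word $y$, $y^T$ is the left infinite word obtained by reversal. A factorization $y^Tb|ax$ of a bi-infinite word marks a position between two letters such that the part to the left is $y^Tb$ and the part to the right is $ax$. -}

module Defs where

open import Data.Nat as ℕ using (ℕ; suc)
open import Data.Integer as ℤ using (ℤ; +_; _+_; _-_)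
open import Data.Integer.DivMod using (_%ℕ_; n%ℕd<d)
open import Data.List using (List; []; _∷_; _++_; length; lookup)
open import Data.Fin using (fromℕ<)
open import Data.Product using (Σ; _×_)
open import Data.Sum using (_⊎_)
open import Data.Unit using (⊤)
open import Relation.Binary.PropositionalEquality using (_≡_; _≢_)

data Letter : Set where
  a b : Letter

Word : Set
Word = List Letter

InfWord : Set
InfWord = ℕ → Letter

BiInfWord : Set
BiInfWord = ℤ → Letter

data Pbar : Word → Word → Set where
  base  : Pbar (a ∷ []) (b ∷ [])
  stepL : ∀ {α β} → Pbar α β → Pbar (α ++ β) β
  stepR : ∀ {α β} → Pbar α β → Pbar α (α ++ β)

posMod : Word → ℤ → ℕ
posMod [] p = 0
posMod (c ∷ cs) p = p %ℕ length (c ∷ cs)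

-- The bi-infinite periodic word w^∞ = ⋯ w w ⋯, with a copy of w
-- occupying indices 0 .. |w|-1 (and hence every block [k|w|, (k+1)|w|)).
-- (For the empty word, which never occurs here, we return a dummy letter.)
periodic : Word → BiInfWord
periodic [] p = a
periodic (c ∷ cs) p =
  lookup (c ∷ cs) (fromℕ< (n%ℕd<d p (length (c ∷ cs))))

-- Convention: position p : ℤ denotes the cut between the letters at
-- indices p - 1 and p of a bi-infinite word W.

Fact-ba : BiInfWord → ℤ → InfWord → InfWord → Set
Fact-ba W p x y =
  (W (p - + 1) ≡ b) × (W p ≡ a) ×
  (∀ k → x k ≡ W (p + + suc k)) × (∀ k → y k ≡ W (p - + (2 ℕ.+ k)))

Fact-ab : BiInfWord → ℤ → InfWord → InfWord → Set
Fact-ab W p x y =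
  (W (p - + 1) ≡ a) × (W p ≡ b) ×
  (∀ k → x k ≡ W (p - + (2 ℕ.+ k))) × (∀ k → y k ≡ W (p + + suc k))

-- The factorizations allowed in the lemma, for (uv)^∞ with uv = v_a u^b:
-- either y^T b | a x not at a boundary uv|uv (position ≢ 0 mod |uv|),
-- or x^T a | b y not at a boundary v_a|u^b (position ≢ |v| mod |uv|).
AdmissibleFact : Word → Word → InfWord → InfWord → Set
AdmissibleFact u v x y =
  Σ ℤ (λ p →
    ((posMod (u ++ v) p ≢ 0) × Fact-ba (periodic (u ++ v)) p x y)
    ⊎ ((posMod (u ++ v) p ≢ length v) × Fact-ab (periodic (u ++ v)) p x y))

Prefix : Word → Word → Set
Prefix w z = Σ Word (λ s → w ++ s ≡ z)

PrefixInf : Word → InfWord → Set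
PrefixInf [] x = ⊤
PrefixInf (c ∷ w) x = (c ≡ x 0) × PrefixInf w (λ k → x (suc k))

IsLCP : InfWord → Word → Word → Set
IsLCP x z w =
  PrefixInf w x × Prefix w z ×
  (∀ w' → PrefixInf w' x → Prefix w' z → length w' ℕ.≤ length w)

-- For (u, v) ∈ P̄ the word aθb = uv is a Lyndon word for the order a < b (strictly smaller
-- than each of its proper rotations) and bθa is a Lyndon word for b < a. Both facts hold for
-- ab and are preserved by the morphisms a ↦ ab, b ↦ b and a ↦ a, b ↦ ab (for bθa: by their
-- letterwise reversals), whose composites generate P̄ from (a, b).
-- Reading (uv)^∞ forwards from an a that does not start a period gives a x, which begins with
-- a proper rotation of aθb. That rotation exceeds aθb, so the first mismatch puts b in x
-- against a in θ (it cannot be the final b of aθb), which is claim (1). As θ is a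
-- palindrome, (uv)^∞ read backwards is (bθa)^∞, and bθa = u^b v_a is the rotation of
-- aθb = v_a u^b by |v|. So each of x and y, in both kinds of factorization, is a forward
-- reading of aθb or bθa from an inner position, and the same argument for the appropriate
-- order gives (1) and (2).
module Submission where

open import Defs
open import Data.Empty using (⊥-elim)
open import Data.Fin using (fromℕ<)
open import Data.Integer using (ℤ; +_; -[1+_]; _+_; _*_; _-_; -_; _%ℕ_; _/ℕ_)
open import Data.Integer.DivMod using (n%ℕd<d; a≡a%ℕn+[a/ℕn]*n)
import Data.Integer.Properties as ℤₚ
open import Data.Integer.Tactic.RingSolver using (solve-∀)
open import Data.List
  using (List; []; _∷_; _++_; length; lookup; reverse; concatMap; take; drop)
open import Data.List.Properties
  using (++-assoc; ++-identityʳ; ++-cancelˡ; ++-conicalʳ; ∷-injective; ∷-injectiveˡ;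
         ∷-injectiveʳ; ∷ʳ-injectiveˡ; concatMap-++; length-++; length-++-comm; length-++-≤ˡ;
         length-take; length-drop; take++drop≡id; reverse-++; unfold-reverse; length-reverse)
open import Data.Nat as ℕ using (ℕ; zero; suc; z≤n; s≤s; _<_; _≤_; NonZero)
import Data.Nat.Properties as ℕₚ
open import Data.Product using (Σ; ∃-syntax; _×_; _,_; proj₂; map₂)
open import Data.Sum using (_⊎_; inj₁; inj₂; map₁)
open import Data.Unit using (tt)
open import Relation.Binary.PropositionalEquality
open import Relation.Nullary using (¬_; contradiction)

private
  variable
    lo hi : Letter
    f : Letter → Word
    u v : Word

a≢b : a ≢ b
a≢b ()

b≢a : b ≢ a
b≢a ()

letter-cases : lo ≢ hi → ∀ c → c ≡ lo ⊎ c ≡ hi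
letter-cases {a} {a} lo≢hi _ = ⊥-elim (lo≢hi refl)
letter-cases {a} {b} _     a = inj₁ refl
letter-cases {a} {b} _     b = inj₂ refl
letter-cases {b} {a} _     a = inj₂ refl
letter-cases {b} {a} _     b = inj₁ refl
letter-cases {b} {b} lo≢hi _ = ⊥-elim (lo≢hi refl)

enclose : Letter → Word → Letter → Word
enclose lo θ hi = lo ∷ θ ++ hi ∷ []

length-snoc : ∀ w (c : Letter) → length (w ++ c ∷ []) ≡ suc (length w)
length-snoc w _ = trans (length-++ w) (ℕₚ.+-comm (length w) 1)

enclose-length : ∀ θ lo hi lo' hi' → length (enclose lo θ hi) ≡ length (enclose lo' θ hi')
enclose-length θ _ hi _ hi' = cong suc (trans (length-snoc θ hi) (sym (length-snoc θ hi')))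

StartsWith : Letter → Word → Set
StartsWith c w = ∃[ h ] w ≡ c ∷ h

-- Lexicographic order and Lyndon words

LexLt : Letter → Letter → Word → Word → Set
LexLt lo hi w w' = ∃[ p ] ∃[ r ] ∃[ r' ] w ≡ p ++ lo ∷ r × w' ≡ p ++ hi ∷ r'

Lyndon : Letter → Letter → Word → Set
Lyndon lo hi w = ∀ s t → s ≢ [] → t ≢ [] → s ++ t ≡ w → LexLt lo hi (s ++ t) (t ++ s)

lexLt-here : ∀ {r r'} → LexLt lo hi (lo ∷ r) (hi ∷ r')
lexLt-here {r = r} {r'} = [] , r , r' , refl , refl

lexLt-++ˡ : ∀ p {w w'} → LexLt lo hi w w' → LexLt lo hi (p ++ w) (p ++ w')
lexLt-++ˡ {lo} {hi} p (q , r , r' , refl , refl) =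
  p ++ q , r , r' , sym (++-assoc p q (lo ∷ r)) , sym (++-assoc p q (hi ∷ r'))

lexLt-irrefl : lo ≢ hi → ∀ {w} → ¬ LexLt lo hi w w
lexLt-irrefl lo≢hi (p , _ , _ , e , e') =
  lo≢hi (∷-injectiveˡ (++-cancelˡ p _ _ (trans (sym e) e')))

lexLt-equal-length : ∀ X Y {Z Z'} → length X ≡ length Y →
  LexLt lo hi (X ++ Z) (Y ++ Z') → LexLt lo hi X Y ⊎ X ≡ Y
lexLt-equal-length []      []      _   _                            = inj₂ refl
lexLt-equal-length (_ ∷ X) (_ ∷ Y) _   ([] , _ , _ , refl , refl)   = inj₁ lexLt-here
lexLt-equal-length (c ∷ X) (_ ∷ Y) len (_ ∷ p , r , r' , e , e')
  with refl , e₁ ← ∷-injective e | refl , e₂ ← ∷-injective e'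
  with lexLt-equal-length X Y (ℕₚ.suc-injective len) (p , r , r' , e₁ , e₂)
... | inj₁ lt   = inj₁ (lexLt-++ˡ (c ∷ []) lt)
... | inj₂ refl = inj₂ refl

lexLt-square : lo ≢ hi → ∀ {X Y} → length X ≡ length Y →
  LexLt lo hi (X ++ X) (Y ++ Y) → LexLt lo hi X Y
lexLt-square lo≢hi {X} {Y} len lt with lexLt-equal-length X Y len lt
... | inj₁ lt'  = lt'
... | inj₂ refl = ⊥-elim (lexLt-irrefl lo≢hi lt)

lyndon-pair : Lyndon lo hi (lo ∷ hi ∷ [])
lyndon-pair []              _           s≢[] _    _    = ⊥-elim (s≢[] refl)
lyndon-pair (_ ∷ _)         []          _    t≢[] _    = ⊥-elim (t≢[] refl)
lyndon-pair (_ ∷ [])        (_ ∷ [])    _    _    refl = lexLt-here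
lyndon-pair (_ ∷ [])        (_ ∷ _ ∷ _) _    _    ()
lyndon-pair (_ ∷ _ ∷ [])    (_ ∷ _)     _    _    ()
lyndon-pair (_ ∷ _ ∷ _ ∷ _) (_ ∷ _)     _    _    ()

-- Elementary morphisms preserve Lyndon words

data Elementary (lo hi : Letter) (f : Letter → Word) : Set where
  lo↦lohi : f lo ≡ lo ∷ hi ∷ [] → f hi ≡ hi ∷ []      → Elementary lo hi f
  hi↦lohi : f lo ≡ lo ∷ []      → f hi ≡ lo ∷ hi ∷ [] → Elementary lo hi f

image-shape : lo ≢ hi → Elementary lo hi f →
  ∀ c → (∃[ x ] f c ≡ x ∷ []) ⊎ (∃[ x ] f c ≡ x ∷ hi ∷ [])
image-shape lo≢hi (lo↦lohi flo fhi) c with letter-cases lo≢hi c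
... | inj₁ refl = inj₂ (_ , flo)
... | inj₂ refl = inj₁ (_ , fhi)
image-shape lo≢hi (hi↦lohi flo fhi) c with letter-cases lo≢hi c
... | inj₁ refl = inj₁ (_ , flo)
... | inj₂ refl = inj₂ (_ , fhi)

images-startWith-lo : lo ≢ hi → f lo ≡ lo ∷ [] → f hi ≡ lo ∷ hi ∷ [] →
  ∀ c → StartsWith lo (f c)
images-startWith-lo lo≢hi flo fhi c with letter-cases lo≢hi c
... | inj₁ refl = _ , flo
... | inj₂ refl = _ , fhi

concatMap-startsWith : Elementary lo hi f → ∀ {w} → StartsWith lo w →
  StartsWith lo (concatMap f w)
concatMap-startsWith {f = f} (lo↦lohi flo _) (h , refl) = _ , cong (_++ concatMap f h) flo
concatMap-startsWith {f = f} (hi↦lohi flo _) (h , refl) = _ , cong (_++ concatMap f h) flo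

concatMap-++-startsWith : (∀ c → StartsWith lo (f c)) →
  ∀ w {H} → StartsWith lo H → StartsWith lo (concatMap f w ++ H)
concatMap-++-startsWith _ [] H-lo = H-lo
concatMap-++-startsWith {f = f} f-lo (c ∷ w) {H} _ with h , fc ← f-lo c =
  _ , trans (++-assoc (f c) (concatMap f w) H) (cong (_++ concatMap f w ++ H) fc)

concatMap-split : ∀ {c P} → f c ≡ P → ∀ p r H →
  concatMap f (p ++ c ∷ r) ++ H ≡ concatMap f p ++ P ++ concatMap f r ++ H
concatMap-split {f} {c} refl p r H = begin
  concatMap f (p ++ c ∷ r) ++ H                ≡⟨ cong (_++ H) (concatMap-++ f p (c ∷ r)) ⟩
  (concatMap f p ++ f c ++ concatMap f r) ++ H ≡⟨ ++-assoc (concatMap f p) _ H ⟩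
  concatMap f p ++ (f c ++ concatMap f r) ++ H ≡⟨ cong (concatMap f p ++_) (++-assoc (f c) _ H) ⟩
  concatMap f p ++ f c ++ concatMap f r ++ H   ∎
  where open ≡-Reasoning

-- Under hi ↦ lo hi the mismatch moves one letter to the right, into the suffix when it was
-- last; the suffixes H, H' keep it in range.
lexLt-concatMap : lo ≢ hi → Elementary lo hi f → ∀ {w w' H H'} → StartsWith lo H →
  LexLt lo hi w w' → LexLt lo hi (concatMap f w ++ H) (concatMap f w' ++ H')
lexLt-concatMap {f = f} _ (lo↦lohi flo fhi) {H = H} {H'} _ (p , r , r' , refl , refl) =
  subst₂ (LexLt _ _) (sym (concatMap-split flo p r H)) (sym (concatMap-split fhi p r' H'))
    (lexLt-++ˡ (concatMap f p) lexLt-here)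
lexLt-concatMap {lo} {f = f} lo≢hi (hi↦lohi flo fhi) {H = H} {H'} H-lo (p , r , r' , refl , refl)
  with k , rH≡ ← concatMap-++-startsWith (images-startWith-lo lo≢hi flo fhi) r H-lo =
  subst₂ (LexLt _ _)
    (sym (trans (concatMap-split flo p r H) (cong (λ z → concatMap f p ++ lo ∷ z) rH≡)))
    (sym (concatMap-split fhi p r' H'))
    (lexLt-++ˡ (concatMap f p) (lexLt-++ˡ (lo ∷ []) lexLt-here))

Cut : (Letter → Word) → Word → Word → Word → Set
Cut f w s' t' = ∃[ s ] ∃[ t ] s ++ t ≡ w × s' ≡ concatMap f s × t' ≡ concatMap f t

cut-∷ : ∀ {c P w s' t'} → f c ≡ P → Cut f w s' t' → Cut f (c ∷ w) (P ++ s') t'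
cut-∷ {f = f} {c} fc (s , t , refl , refl , refl) =
  c ∷ s , t , refl , cong (_++ concatMap f s) (sym fc) , refl

concatMap-cut : lo ≢ hi → Elementary lo hi f → ∀ w s' t' → s' ++ t' ≡ concatMap f w →
  Cut f w s' t' ⊎ StartsWith hi t'
concatMap-cut _ _ w [] t' eq = inj₁ ([] , w , refl , refl , eq)
concatMap-cut {f = f} lo≢hi el (c ∷ w) (x ∷ s') t' eq with image-shape lo≢hi el c
... | inj₁ (_ , fc) with refl , eq' ← ∷-injective (trans eq (cong (_++ concatMap f w) fc)) =
  map₁ (cut-∷ fc) (concatMap-cut lo≢hi el w s' t' eq')
... | inj₂ (_ , fc) with refl , eq' ← ∷-injective (trans eq (cong (_++ concatMap f w) fc))
  with s'
...   | []      = inj₂ (_ , eq')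
...   | _ ∷ s'' with refl , eq'' ← ∷-injective eq' =
  map₁ (cut-∷ fc) (concatMap-cut lo≢hi el w s'' t' eq'')

length-concatMap-swap : ∀ (f : Letter → Word) s t →
  length (concatMap f (s ++ t)) ≡ length (concatMap f (t ++ s))
length-concatMap-swap f s t = begin
  length (concatMap f (s ++ t))           ≡⟨ cong length (concatMap-++ f s t) ⟩
  length (concatMap f s ++ concatMap f t) ≡⟨ length-++-comm (concatMap f s) _ ⟩
  length (concatMap f t ++ concatMap f s) ≡⟨ cong length (concatMap-++ f t s) ⟨
  length (concatMap f (t ++ s))           ∎
  where open ≡-Reasoning

-- A cut between the images of two letters comes from a rotation of w, and its inequality is
-- transported to the doubled images; a cut inside an image lo hi starts the rotation with hi.
lyndon-concatMap : lo ≢ hi → Elementary lo hi f → ∀ {w} → StartsWith lo w → Lyndon lo hi w →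
  Lyndon lo hi (concatMap f w)
lyndon-concatMap {lo} {hi} {f} lo≢hi el {w} w-lo lyn s' t' s'≢[] t'≢[] eq
  with concatMap-cut lo≢hi el w s' t' eq
... | inj₁ (s , t , refl , refl , refl) =
  subst₂ (LexLt lo hi) (concatMap-++ f s t) (concatMap-++ f t s)
    (lexLt-square lo≢hi (length-concatMap-swap f s t)
      (lexLt-concatMap lo≢hi el (concatMap-startsWith el w-lo)
        (lyn s t (λ { refl → s'≢[] refl }) (λ { refl → t'≢[] refl }) refl)))
... | inj₂ (_ , refl) with s' | concatMap-startsWith el w-lo
...   | []      | _        = ⊥-elim (s'≢[] refl)
...   | _ ∷ _   | _ , fw≡ with refl ← ∷-injectiveˡ (trans eq fw≡) = lexLt-here

-- The pairs of P̄ as morphic images of (a, b)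

g d gʳ dʳ : Letter → Word
g a  = a ∷ b ∷ []
g b  = b ∷ []
d a  = a ∷ []
d b  = a ∷ b ∷ []
gʳ a = b ∷ a ∷ []
gʳ b = b ∷ []
dʳ a = a ∷ []
dʳ b = b ∷ a ∷ []

data Image : Word → Word → Set where
  ab    : Image (a ∷ []) (b ∷ [])
  img-g : Image u v → Image (concatMap g u) (concatMap g v)
  img-d : Image u v → Image (concatMap d u) (concatMap d v)

-- The steps of P̄ compose with g and d on the inside, Image composes on the outside.
image-stepL : Image u v → Image (u ++ v) v
image-stepL ab = img-g ab
image-stepL (img-g {u} {v} i) =
  subst (λ w → Image w (concatMap g v)) (concatMap-++ g u v) (img-g (image-stepL i))
image-stepL (img-d {u} {v} i) =
  subst (λ w → Image w (concatMap d v)) (concatMap-++ d u v) (img-d (image-stepL i))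

image-stepR : Image u v → Image u (u ++ v)
image-stepR ab = img-d ab
image-stepR (img-g {u} {v} i) =
  subst (Image (concatMap g u)) (concatMap-++ g u v) (img-g (image-stepR i))
image-stepR (img-d {u} {v} i) =
  subst (Image (concatMap d u)) (concatMap-++ d u v) (img-d (image-stepR i))

pbar-image : Pbar u v → Image u v
pbar-image base      = ab
pbar-image (stepL p) = image-stepL (pbar-image p)
pbar-image (stepR p) = image-stepR (pbar-image p)

concatMap-∷ʳ : ∀ (f : Letter → Word) w c → concatMap f (w ++ c ∷ []) ≡ concatMap f w ++ f c
concatMap-∷ʳ f w c =
  trans (concatMap-++ f w (c ∷ [])) (cong (concatMap f w ++_) (++-identityʳ (f c)))

gʳ-conjugate : ∀ θ → concatMap gʳ θ ++ b ∷ [] ≡ b ∷ concatMap g θ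
gʳ-conjugate []      = refl
gʳ-conjugate (a ∷ θ) = cong (λ w → b ∷ a ∷ w) (gʳ-conjugate θ)
gʳ-conjugate (b ∷ θ) = cong (b ∷_) (gʳ-conjugate θ)

d-conjugate : ∀ θ → concatMap d θ ++ a ∷ [] ≡ a ∷ concatMap dʳ θ
d-conjugate []      = refl
d-conjugate (a ∷ θ) = cong (a ∷_) (d-conjugate θ)
d-conjugate (b ∷ θ) = cong (λ w → a ∷ b ∷ w) (d-conjugate θ)

enclose-g : ∀ θ → concatMap g (enclose a θ b) ≡ enclose a (b ∷ concatMap g θ) b
enclose-g θ = cong (λ w → a ∷ b ∷ w) (concatMap-∷ʳ g θ b)

enclose-gʳ : ∀ θ → concatMap gʳ (enclose b θ a) ≡ enclose b (b ∷ concatMap g θ) a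
enclose-gʳ θ = cong (b ∷_) (begin
  concatMap gʳ (θ ++ a ∷ [])           ≡⟨ concatMap-∷ʳ gʳ θ a ⟩
  concatMap gʳ θ ++ b ∷ a ∷ []         ≡⟨ ++-assoc (concatMap gʳ θ) (b ∷ []) (a ∷ []) ⟨
  (concatMap gʳ θ ++ b ∷ []) ++ a ∷ [] ≡⟨ cong (_++ a ∷ []) (gʳ-conjugate θ) ⟩
  (b ∷ concatMap g θ) ++ a ∷ []        ∎)
  where open ≡-Reasoning

enclose-d : ∀ θ → concatMap d (enclose a θ b) ≡ enclose a (concatMap d θ ++ a ∷ []) b
enclose-d θ = cong (a ∷_)
  (trans (concatMap-∷ʳ d θ b) (sym (++-assoc (concatMap d θ) (a ∷ []) (b ∷ []))))

enclose-dʳ : ∀ θ → concatMap dʳ (enclose b θ a) ≡ enclose b (concatMap d θ ++ a ∷ []) a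
enclose-dʳ θ = cong (b ∷_)
  (trans (cong (a ∷_) (concatMap-∷ʳ dʳ θ a)) (cong (_++ a ∷ []) (sym (d-conjugate θ))))

image-lyndon : Image u v →
  ∃[ θ ] u ++ v ≡ enclose a θ b × Lyndon a b (enclose a θ b) × Lyndon b a (enclose b θ a)
image-lyndon ab = [] , refl , lyndon-pair , lyndon-pair
image-lyndon (img-g {u} {v} i) with θ , uv≡ , lower , upper ← image-lyndon i =
  b ∷ concatMap g θ ,
  trans (sym (concatMap-++ g u v)) (trans (cong (concatMap g) uv≡) (enclose-g θ)) ,
  subst (Lyndon a b) (enclose-g θ)
    (lyndon-concatMap {f = g} a≢b (lo↦lohi refl refl) (_ , refl) lower) ,
  subst (Lyndon b a) (enclose-gʳ θ)
    (lyndon-concatMap {f = gʳ} b≢a (hi↦lohi refl refl) (_ , refl) upper)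
image-lyndon (img-d {u} {v} i) with θ , uv≡ , lower , upper ← image-lyndon i =
  concatMap d θ ++ a ∷ [] ,
  trans (sym (concatMap-++ d u v)) (trans (cong (concatMap d) uv≡) (enclose-d θ)) ,
  subst (Lyndon a b) (enclose-d θ)
    (lyndon-concatMap {f = d} a≢b (hi↦lohi refl refl) (_ , refl) lower) ,
  subst (Lyndon b a) (enclose-dʳ θ)
    (lyndon-concatMap {f = dʳ} b≢a (lo↦lohi refl refl) (_ , refl) upper)

Palindrome : Word → Set
Palindrome w = reverse w ≡ w

enclose-reverse : ∀ {θ} → Palindrome θ → reverse (enclose lo θ hi) ≡ enclose hi θ lo
enclose-reverse {lo} {hi} {θ} θ-pal = begin
  reverse (lo ∷ θ ++ hi ∷ [])       ≡⟨ unfold-reverse lo (θ ++ hi ∷ []) ⟩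
  reverse (θ ++ hi ∷ []) ++ lo ∷ [] ≡⟨ cong (_++ lo ∷ []) (reverse-++ θ (hi ∷ [])) ⟩
  (hi ∷ reverse θ) ++ lo ∷ []       ≡⟨ cong (λ w → hi ∷ w ++ lo ∷ []) θ-pal ⟩
  enclose hi θ lo                   ∎
  where open ≡-Reasoning

central-palindrome : ∀ r s → (a ∷ r) ++ (s ++ b ∷ []) ≡ (s ++ a ∷ []) ++ b ∷ r →
  Palindrome (s ++ a ∷ []) → Palindrome (b ∷ r) → Palindrome (r ++ s)
central-palindrome r s E sa-pal br-pal =
  trans (reverse-++ r s) (∷ʳ-injectiveˡ (reverse s ++ reverse r) (r ++ s) (∷-injectiveʳ enclosed))
  where
  open ≡-Reasoning
  enclosed : a ∷ (reverse s ++ reverse r) ++ b ∷ [] ≡ a ∷ (r ++ s) ++ b ∷ []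
  enclosed = begin
    a ∷ (reverse s ++ reverse r) ++ b ∷ [] ≡⟨ cong (a ∷_) (++-assoc (reverse s) (reverse r) (b ∷ [])) ⟩
    (a ∷ reverse s) ++ reverse r ++ b ∷ [] ≡⟨ cong₂ _++_ (trans (sym (reverse-++ s (a ∷ []))) sa-pal)
                                                        (trans (sym (unfold-reverse b r)) br-pal) ⟩
    (s ++ a ∷ []) ++ b ∷ r                 ≡⟨ E ⟨
    a ∷ r ++ s ++ b ∷ []                   ≡⟨ cong (a ∷_) (++-assoc r s (b ∷ [])) ⟨
    a ∷ (r ++ s) ++ b ∷ []                 ∎

-- uv = v_a u^b with both factors palindromes, where u = a r and v = s b.
PalindromicSplit : Word → Word → Set
PalindromicSplit u v = ∃[ r ] ∃[ s ] u ≡ a ∷ r × v ≡ s ++ b ∷ [] ×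
  u ++ v ≡ (s ++ a ∷ []) ++ b ∷ r × Palindrome (s ++ a ∷ []) × Palindrome (b ∷ r)

pbar-palindromic : Pbar u v → PalindromicSplit u v
pbar-palindromic base = [] , [] , refl , refl , refl , refl , refl
pbar-palindromic (stepL p) with r , s , refl , refl , E , sa-pal , br-pal ← pbar-palindromic p =
  r ++ s ++ b ∷ [] , s , refl , refl ,
  trans (cong (_++ s ++ b ∷ []) E) (++-assoc (s ++ a ∷ []) (b ∷ r) (s ++ b ∷ [])) ,
  sa-pal ,
  subst (λ q → Palindrome (b ∷ q)) (++-assoc r s (b ∷ []))
    (enclose-reverse (central-palindrome r s E sa-pal br-pal))
pbar-palindromic (stepR p) with r , s , refl , refl , E , sa-pal , br-pal ← pbar-palindromic p =
  r , a ∷ r ++ s , refl , cong (a ∷_) (sym (++-assoc r s (b ∷ []))) ,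
  trans (cong ((a ∷ r) ++_) E)
    (cong (a ∷_) (trans (sym (++-assoc r (s ++ a ∷ []) (b ∷ r)))
                        (cong (_++ b ∷ r) (sym (++-assoc r s (a ∷ [])))))) ,
  enclose-reverse (central-palindrome r s E sa-pal br-pal) ,
  br-pal

-- Residues and periodic words

-- Total indexing: out of range it returns the junk letter a.
nth : Word → ℕ → Letter
nth []      _       = a
nth (c ∷ _) zero    = c
nth (_ ∷ w) (suc i) = nth w i

lookup-nth : ∀ w {i} (i<n : i < length w) → lookup w (fromℕ< i<n) ≡ nth w i
lookup-nth (_ ∷ _) {zero}  _         = refl
lookup-nth (_ ∷ w) {suc i} (s≤s i<n) = lookup-nth w i<n

nth-++ˡ : ∀ w w' {i} → i < length w → nth (w ++ w') i ≡ nth w i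
nth-++ˡ (_ ∷ _) _  {zero}  _        = refl
nth-++ˡ (_ ∷ w) w' {suc i} (s≤s i<) = nth-++ˡ w w' i<

nth-length : ∀ w c w' → nth (w ++ c ∷ w') (length w) ≡ c
nth-length []      _ _  = refl
nth-length (_ ∷ w) c w' = nth-length w c w'

nth-reverse : ∀ w {i j} → suc (i ℕ.+ j) ≡ length w → nth (reverse w) i ≡ nth w j
nth-reverse (c ∷ w) {i} {zero} e rewrite unfold-reverse c w =
  trans (cong (nth (reverse w ++ c ∷ [])) i≡) (nth-length (reverse w) c [])
  where
  i≡ : i ≡ length (reverse w)
  i≡ = trans (sym (ℕₚ.+-identityʳ i)) (trans (ℕₚ.suc-injective e) (sym (length-reverse w)))
nth-reverse (c ∷ w) {i} {suc j} e rewrite unfold-reverse c w =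
  trans (nth-++ˡ (reverse w) (c ∷ []) i<) (nth-reverse w e')
  where
  e' : suc (i ℕ.+ j) ≡ length w
  e' = trans (sym (ℕₚ.+-suc i j)) (ℕₚ.suc-injective e)
  i< : i < length (reverse w)
  i< = subst (i <_) (trans e' (sym (length-reverse w))) (s≤s (ℕₚ.m≤m+n i j))

Multiple : ℕ → ℤ → Set
Multiple n z = ∃[ m ] z ≡ m * + n

below-plus-multiple : ∀ {n r r'} q → r < n → r ≡ r' ℕ.+ q ℕ.* n → r ≡ r'
below-plus-multiple zero _ e = trans e (ℕₚ.+-identityʳ _)
below-plus-multiple {n} {r' = r'} (suc q) r<n refl =
  contradiction r<n (ℕₚ.≤⇒≯ (ℕₚ.≤-trans (ℕₚ.m≤m+n n (q ℕ.* n)) (ℕₚ.m≤n+m _ r')))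

residue-unique : ∀ {n r r'} m → r < n → r' < n → + r ≡ + r' + m * + n → r ≡ r'
residue-unique {n} {r' = r'} (+ q) r<n _ e =
  below-plus-multiple q r<n (ℤₚ.+-injective (trans e (cong (_+_ (+ r')) (sym (ℤₚ.pos-* q n)))))
residue-unique {n} {r} {r'} -[1+ q ] r<n r'<n e =
  sym (residue-unique (+ suc q) r'<n r<n
        (trans (move (+ r') -[1+ q ] (+ n)) (cong (_+ + suc q * + n) (sym e))))
  where
  move : ∀ X M N → X ≡ (X + M * N) + (- M) * N
  move = solve-∀

%ℕ-unique : ∀ z {n r} .{{_ : NonZero n}} m → r < n → z ≡ + r + m * + n → z %ℕ n ≡ r
%ℕ-unique z {n} {r} m r<n z≡ = residue-unique (m - z /ℕ n) (n%ℕd<d z n) r<n (begin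
  + (z %ℕ n)                                 ≡⟨ cancel (+ (z %ℕ n)) (z /ℕ n) (+ n) ⟩
  (+ (z %ℕ n) + z /ℕ n * + n) - z /ℕ n * + n ≡⟨ cong (_- z /ℕ n * + n) (a≡a%ℕn+[a/ℕn]*n z n) ⟨
  z - z /ℕ n * + n                           ≡⟨ cong (_- z /ℕ n * + n) z≡ ⟩
  (+ r + m * + n) - z /ℕ n * + n             ≡⟨ regroup (+ r) m (z /ℕ n) (+ n) ⟩
  + r + (m - z /ℕ n) * + n                   ∎)
  where
  open ≡-Reasoning
  cancel : ∀ R Q N → R ≡ (R + Q * N) - Q * N
  cancel = solve-∀
  regroup : ∀ R M Q N → (R + M * N) - Q * N ≡ R + (M - Q) * N
  regroup = solve-∀

residue-decomposition : ∀ z n .{{_ : NonZero n}} → ∃[ r ] ∃[ q ] r < n × z ≡ + r + q * + n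
residue-decomposition z n = z %ℕ n , z /ℕ n , n%ℕd<d z n , a≡a%ℕn+[a/ℕn]*n z n

posMod-unique : ∀ w {p r} m → r < length w → p ≡ + r + m * + length w → posMod w p ≡ r
posMod-unique (_ ∷ _) {p} m = %ℕ-unique p m

posMod-of-offset : ∀ w {p r z} → r < length w → z ≡ p - + r ⊎ z ≡ + r - p →
  Multiple (length w) z → posMod w p ≡ r
posMod-of-offset w {p} {r} r<n (inj₁ z≡) (m , z≡m) = posMod-unique w m r<n (begin
  p                    ≡⟨ split p (+ r) ⟩
  + r + (p - + r)      ≡⟨ cong (_+_ (+ r)) (trans (sym z≡) z≡m) ⟩
  + r + m * + length w ∎)
  where
  open ≡-Reasoning
  split : ∀ P R → P ≡ R + (P - R)
  split = solve-∀
posMod-of-offset w {p} {r} r<n (inj₂ z≡) (m , z≡m) = posMod-unique w (- m) r<n (begin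
  p                        ≡⟨ split p (+ r) ⟩
  + r + - (+ r - p)        ≡⟨ cong (λ q → + r + - q) (trans (sym z≡) z≡m) ⟩
  + r + - (m * + length w) ≡⟨ cong (_+_ (+ r)) (ℤₚ.neg-distribˡ-* m (+ length w)) ⟩
  + r + (- m) * + length w ∎)
  where
  open ≡-Reasoning
  split : ∀ P R → P ≡ R + - (R - P)
  split = solve-∀

periodic-index : ∀ w {n r z} m → length w ≡ n → r < n → z ≡ + r + m * + n →
  periodic w z ≡ nth w r
periodic-index w@(_ ∷ _) {z = z} m refl r<n z≡ =
  trans (lookup-nth w (n%ℕd<d z (length w))) (cong (nth w) (%ℕ-unique z m r<n z≡))

periodic-shift : ∀ w z m → periodic w (z + m * + length w) ≡ periodic w z
periodic-shift []        _ _ = refl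
periodic-shift w@(_ ∷ _) z m with r , q , r<n , z≡ ← residue-decomposition z (length w) =
  trans (periodic-index w (q + m) refl r<n
          (trans (cong (_+ m * + length w) z≡) (regroup (+ r) q m (+ length w))))
        (sym (periodic-index w q refl r<n z≡))
  where
  regroup : ∀ R Q M N → (R + Q * N) + M * N ≡ R + (Q + M) * N
  regroup = solve-∀

periodic-snoc : ∀ w c z → periodic (w ++ c ∷ []) z ≡ periodic (c ∷ w) (z + + 1)
periodic-snoc w c z with j , q , j<n , z≡ ← residue-decomposition z (suc (length w))
  with ℕₚ.m<1+n⇒m<n∨m≡n j<n
... | inj₁ j<|w| = begin
  periodic (w ++ c ∷ []) z   ≡⟨ periodic-index (w ++ c ∷ []) q (length-snoc w c) j<n z≡ ⟩
  nth (w ++ c ∷ []) j        ≡⟨ nth-++ˡ w (c ∷ []) j<|w| ⟩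
  nth w j                    ≡⟨ periodic-index (c ∷ w) q refl (s≤s j<|w|)
                                   (trans (cong (_+ + 1) z≡) (step (+ j) q _)) ⟨
  periodic (c ∷ w) (z + + 1) ∎
  where
  open ≡-Reasoning
  step : ∀ J Q N → (J + Q * N) + + 1 ≡ (+ 1 + J) + Q * N
  step = solve-∀
... | inj₂ refl = begin
  periodic (w ++ c ∷ []) z     ≡⟨ periodic-index (w ++ c ∷ []) q (length-snoc w c) j<n z≡ ⟩
  nth (w ++ c ∷ []) (length w) ≡⟨ nth-length w c [] ⟩
  c                            ≡⟨ periodic-index (c ∷ w) (q + + 1) refl (s≤s z≤n)
                                     (trans (cong (_+ + 1) z≡) (wrap (+ length w) q)) ⟨
  periodic (c ∷ w) (z + + 1)   ∎
  where
  open ≡-Reasoning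
  wrap : ∀ J Q → (J + Q * (+ 1 + J)) + + 1 ≡ + 0 + (Q + + 1) * (+ 1 + J)
  wrap = solve-∀

periodic-rotate : ∀ s t z → periodic (t ++ s) z ≡ periodic (s ++ t) (z + + length s)
periodic-rotate []      t z = cong₂ periodic (++-identityʳ t) (sym (ℤₚ.+-identityʳ z))
periodic-rotate (c ∷ s) t z = begin
  periodic (t ++ c ∷ s) z                        ≡⟨ cong (λ w → periodic w z) (++-assoc t (c ∷ []) s) ⟨
  periodic ((t ++ c ∷ []) ++ s) z                ≡⟨ periodic-rotate s (t ++ c ∷ []) z ⟩
  periodic (s ++ t ++ c ∷ []) (z + + length s)   ≡⟨ cong (λ w → periodic w (z + + length s))
                                                         (++-assoc s t (c ∷ [])) ⟨
  periodic ((s ++ t) ++ c ∷ []) (z + + length s) ≡⟨ periodic-snoc (s ++ t) c (z + + length s) ⟩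
  periodic (c ∷ s ++ t) (z + + length s + + 1)   ≡⟨ cong (periodic (c ∷ s ++ t)) (shift z (+ length s)) ⟩
  periodic (c ∷ s ++ t) (z + + suc (length s))   ∎
  where
  open ≡-Reasoning
  shift : ∀ Z S → Z + S + + 1 ≡ Z + (+ 1 + S)
  shift = solve-∀

periodic-reverse : ∀ w z → periodic (reverse w) z ≡ periodic w (- z - + 1)
periodic-reverse []          _ = refl
periodic-reverse w@(_ ∷ cs) z with j , q , j<n , z≡ ← residue-decomposition z (length w)
  with i , j+i≡ ← ℕₚ.m≤n⇒∃[o]m+o≡n (ℕₚ.≤-pred j<n) = begin
  periodic (reverse w) z ≡⟨ periodic-index (reverse w) q (length-reverse w) j<n z≡ ⟩
  nth (reverse w) j      ≡⟨ nth-reverse w (cong suc j+i≡) ⟩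
  nth w i                ≡⟨ periodic-index w (- q - + 1) refl i<n reflected ⟨
  periodic w (- z - + 1) ∎
  where
  open ≡-Reasoning
  i<n : i < length w
  i<n = s≤s (subst (i ≤_) j+i≡ (ℕₚ.m≤n+m i j))
  mirror : ∀ J I Q → - (J + Q * (+ 1 + (J + I))) - + 1 ≡ I + (- Q - + 1) * (+ 1 + (J + I))
  mirror = solve-∀
  reflected : - z - + 1 ≡ + i + (- q - + 1) * + length w
  reflected = begin
    - z - + 1                               ≡⟨ cong (λ z → - z - + 1) z≡ ⟩
    - (+ j + q * + length w) - + 1          ≡⟨ cong (λ k → - (+ j + q * + suc k) - + 1) j+i≡ ⟨
    - (+ j + q * (+ 1 + (+ j + + i))) - + 1 ≡⟨ mirror (+ j) (+ i) q ⟩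
    + i + (- q - + 1) * (+ 1 + (+ j + + i)) ≡⟨ cong (λ k → + i + (- q - + 1) * + suc k) j+i≡ ⟩
    + i + (- q - + 1) * + length w          ∎

rotation-at : ∀ w {z} .{{_ : NonZero (length w)}} → ¬ Multiple (length w) z →
  ∃[ s ] ∃[ t ] s ++ t ≡ w × s ≢ [] × t ≢ [] ×
    (∀ j → periodic w (z + + j) ≡ periodic (t ++ s) (+ j))
rotation-at w {z} z∉nℤ with r , q , r<n , z≡ ← residue-decomposition z (length w) =
  s , t , take++drop≡id r w , s≢[] , t≢[] , reading
  where
  open ≡-Reasoning
  s t : Word
  s = take r w
  t = drop r w
  |s|≡r : length s ≡ r
  |s|≡r = trans (length-take r w) (ℕₚ.m≤n⇒m⊓n≡m (ℕₚ.<⇒≤ r<n))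
  s≢[] : s ≢ []
  s≢[] s≡[] = z∉nℤ (q , trans z≡
    (trans (cong (λ r → + r + q * + length w) (trans (sym |s|≡r) (cong length s≡[])))
           (ℤₚ.+-identityˡ _)))
  t≢[] : t ≢ []
  t≢[] t≡[] = ℕₚ.<-irrefl refl
    (subst (0 <_) (trans (sym (length-drop r w)) (cong length t≡[])) (ℕₚ.m<n⇒0<n∸m r<n))
  regroup : ∀ R Q N J → (R + Q * N) + J ≡ (J + R) + Q * N
  regroup = solve-∀
  reading : ∀ j → periodic w (z + + j) ≡ periodic (t ++ s) (+ j)
  reading j = begin
    periodic w (z + + j)                    ≡⟨ cong (λ z → periodic w (z + + j)) z≡ ⟩
    periodic w (+ r + q * + length w + + j) ≡⟨ cong (periodic w) (regroup (+ r) q _ (+ j)) ⟩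
    periodic w (+ j + + r + q * + length w) ≡⟨ periodic-shift w (+ j + + r) q ⟩
    periodic w (+ j + + r)                  ≡⟨ cong (λ r → periodic w (+ j + + r)) |s|≡r ⟨
    periodic w (+ j + + length s)           ≡⟨ cong (λ u → periodic u (+ j + + length s))
                                                      (take++drop≡id r w) ⟨
    periodic (s ++ t) (+ j + + length s)    ≡⟨ periodic-rotate s t (+ j) ⟨
    periodic (t ++ s) (+ j)                 ∎

prefixInf-nth : ∀ q (x : InfWord) → (∀ k → k < length q → nth q k ≡ x k) → PrefixInf q x
prefixInf-nth []      _ _ = tt
prefixInf-nth (_ ∷ q) x h =
  h 0 (s≤s z≤n) , prefixInf-nth q (λ k → x (suc k)) (λ k k< → h (suc k) (s≤s k<))

prefixInf-resp : ∀ q {x y : InfWord} → (∀ k → x k ≡ y k) → PrefixInf q x → PrefixInf q y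
prefixInf-resp []      _   _           = tt
prefixInf-resp (_ ∷ q) x≡y (c≡ , rest) = trans c≡ (x≡y 0) , prefixInf-resp q (λ k → x≡y (suc k)) rest

prefix-periodic : ∀ {q} w → Prefix q w → PrefixInf q (λ k → periodic w (+ k))
prefix-periodic {q} _ (S , refl) = prefixInf-nth q _ λ k k< →
  sym (trans (periodic-index (q ++ S) (+ 0) refl (ℕₚ.<-≤-trans k< (length-++-≤ˡ q))
                             (sym (ℤₚ.+-identityʳ (+ k))))
             (nth-++ˡ q S k<))

DivergesAfterLCP : Letter → Letter → InfWord → Word → Set
DivergesAfterLCP lo hi x θ =
  ∀ θ₁ → IsLCP x θ θ₁ → PrefixInf (θ₁ ++ hi ∷ []) x × Prefix (θ₁ ++ lo ∷ []) θ

isLCP-tail : ∀ {x : InfWord} {c c' θ θ₁} → IsLCP x (c ∷ θ) (c' ∷ θ₁) →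
  IsLCP (λ k → x (suc k)) θ θ₁
isLCP-tail {c = c} ((c'≡x₀ , θ₁-x) , (S , e) , longest) =
  θ₁-x , (S , ∷-injectiveʳ e) , λ w w-x (S' , e') →
    ℕₚ.≤-pred (longest (c ∷ w) (trans (sym (∷-injectiveˡ e)) c'≡x₀ , w-x) (S' , cong (c ∷_) e'))

lcp-at-mismatch : lo ≢ hi → ∀ {x : InfWord} P θ θ₁ →
  PrefixInf (P ++ hi ∷ []) x → Prefix (P ++ lo ∷ []) θ → IsLCP x θ θ₁ → θ₁ ≡ P
lcp-at-mismatch _ [] _ [] _ _ _ = refl
lcp-at-mismatch lo≢hi [] _ (_ ∷ _) (hi≡x₀ , _) (_ , refl) ((c≡x₀ , _) , (_ , e) , _) =
  ⊥-elim (lo≢hi (trans (sym (∷-injectiveˡ e)) (trans c≡x₀ (sym hi≡x₀))))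
lcp-at-mismatch _ (p ∷ P) _ [] (p≡x₀ , _) (S , refl) (_ , _ , longest) =
  contradiction (longest (p ∷ []) (p≡x₀ , tt) ((P ++ _ ∷ []) ++ S , refl)) λ ()
lcp-at-mismatch lo≢hi (p ∷ P) _ (_ ∷ θ₁) (_ , P-x) (S , refl) lcp@(_ , (_ , e) , _) =
  cong₂ _∷_ (∷-injectiveˡ e) (lcp-at-mismatch lo≢hi P _ θ₁ P-x (S , refl) (isLCP-tail lcp))

prefix-before-last : lo ≢ hi → ∀ P θ {r} → θ ++ hi ∷ [] ≡ P ++ lo ∷ r → Prefix (P ++ lo ∷ []) θ
prefix-before-last lo≢hi []      []      e = ⊥-elim (lo≢hi (sym (∷-injectiveˡ e)))
prefix-before-last _     []      (_ ∷ θ) e with refl ← ∷-injectiveˡ e = θ , refl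
prefix-before-last _     (_ ∷ P) []      e =
  contradiction (++-conicalʳ P _ (sym (∷-injectiveʳ e))) λ ()
prefix-before-last lo≢hi (_ ∷ P) (c ∷ θ) e with refl ← ∷-injectiveˡ e =
  map₂ (cong (c ∷_)) (prefix-before-last lo≢hi P θ (∷-injectiveʳ e))

rotation-mismatch : lo ≢ hi → ∀ {θ} → Lyndon lo hi (enclose lo θ hi) →
  ∀ s t → s ++ t ≡ enclose lo θ hi → s ≢ [] → t ≢ [] → StartsWith lo (t ++ s) →
  ∃[ P ] Prefix (P ++ lo ∷ []) θ × Prefix (lo ∷ P ++ hi ∷ []) (t ++ s)
rotation-mismatch lo≢hi lyn s t st≡ s≢[] t≢[] (_ , ts≡) with lyn s t s≢[] t≢[] st≡
... | [] , _ , _ , _ , ts≡' = ⊥-elim (lo≢hi (∷-injectiveˡ (trans (sym ts≡) ts≡')))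
... | _ ∷ P , _ , r' , st≡' , ts≡' with refl ← ∷-injectiveˡ (trans (sym st≡) st≡') =
  P , prefix-before-last lo≢hi P _ (∷-injectiveʳ (trans (sym st≡) st≡')) ,
  r' , trans (++-assoc (_ ∷ P) (_ ∷ []) r') (sym ts≡')

lyndon-reading : lo ≢ hi → ∀ {θ z} {x : InfWord} → Lyndon lo hi (enclose lo θ hi) →
  ¬ Multiple (length (enclose lo θ hi)) z → periodic (enclose lo θ hi) z ≡ lo →
  (∀ j → x j ≡ periodic (enclose lo θ hi) (z + + suc j)) → DivergesAfterLCP lo hi x θ
lyndon-reading {lo} {hi} lo≢hi {θ} {z} {x} lyn z∉nℤ z↦lo x≡ θ₁ lcp
  with rotation-at (enclose lo θ hi) z∉nℤ
... | _ , [] , _ , _ , t≢[] , _ = ⊥-elim (t≢[] refl)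
... | s , t@(c ∷ t') , st≡ , s≢[] , t≢[] , reading
  with c≡lo ← trans (sym (reading 0)) (trans (cong (periodic _) (ℤₚ.+-identityʳ z)) z↦lo)
  with P , θ-P , ts-P ← rotation-mismatch lo≢hi lyn s t st≡ s≢[] t≢[]
                                           (t' ++ s , cong (_∷ t' ++ s) c≡lo) =
  subst (λ θ₁ → PrefixInf (θ₁ ++ hi ∷ []) x × Prefix (θ₁ ++ lo ∷ []) θ) (sym θ₁≡P) (x-P , θ-P)
  where
  x-P : PrefixInf (P ++ hi ∷ []) x
  x-P = prefixInf-resp (P ++ hi ∷ []) (λ j → sym (trans (x≡ j) (reading (suc j))))
          (proj₂ (prefix-periodic (t ++ s) ts-P))
  θ₁≡P : θ₁ ≡ P
  θ₁≡P = lcp-at-mismatch lo≢hi P θ θ₁ x-P θ-P lcp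

-- k is |v|: bθa = u^b v_a is the rotation of aθb = v_a u^b by |v_a| = |v|.
record Christoffel (θ : Word) (k : ℕ) : Set where
  field
    lower-lyndon : Lyndon a b (enclose a θ b)
    upper-lyndon : Lyndon b a (enclose b θ a)
    palindrome   : Palindrome θ
    k<length     : k < length (enclose a θ b)
    rotation     : ∀ z → periodic (enclose b θ a) z ≡ periodic (enclose a θ b) (z + + k)

split-rotation : ∀ r s → (a ∷ r) ++ (s ++ b ∷ []) ≡ (s ++ a ∷ []) ++ b ∷ r → ∀ z →
  periodic (enclose b (r ++ s) a) z ≡ periodic (enclose a (r ++ s) b) (z + + length (s ++ b ∷ []))
split-rotation r s E z = begin
  periodic (enclose b (r ++ s) a) z              ≡⟨ cong (λ w → periodic (b ∷ w) z) (++-assoc r s (a ∷ [])) ⟩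
  periodic ((b ∷ r) ++ s ++ a ∷ []) z            ≡⟨ periodic-rotate (s ++ a ∷ []) (b ∷ r) z ⟩
  periodic ((s ++ a ∷ []) ++ b ∷ r) (z + + |sa|) ≡⟨ cong₂ periodic (sym E)
                                                         (cong (λ n → z + + n) |sa|≡|sb|) ⟩
  periodic ((a ∷ r) ++ s ++ b ∷ []) (z + + |sb|) ≡⟨ cong (λ w → periodic (a ∷ w) (z + + |sb|))
                                                         (++-assoc r s (b ∷ [])) ⟨
  periodic (enclose a (r ++ s) b) (z + + |sb|)   ∎
  where
  open ≡-Reasoning
  |sa| |sb| : ℕ
  |sa| = length (s ++ a ∷ [])
  |sb| = length (s ++ b ∷ [])
  |sa|≡|sb| : |sa| ≡ |sb|
  |sa|≡|sb| = trans (length-snoc s a) (sym (length-snoc s b))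

pbar-christoffel : ∀ {θ} → Pbar u v → u ++ v ≡ enclose a θ b → Christoffel θ (length v)
pbar-christoffel {θ = θ} uv∈P̄ uv≡ with θ' , uv≡' , lower , upper ← image-lyndon (pbar-image uv∈P̄)
  with refl ← ∷ʳ-injectiveˡ θ' θ (∷-injectiveʳ (trans (sym uv≡') uv≡))
  with r , s , refl , refl , E , sa-pal , br-pal ← pbar-palindromic uv∈P̄
  with refl ← ∷ʳ-injectiveˡ (r ++ s) θ (trans (++-assoc r s (b ∷ [])) (∷-injectiveʳ uv≡)) = record
  { lower-lyndon = lower
  ; upper-lyndon = upper
  ; palindrome   = central-palindrome r s E sa-pal br-pal
  ; k<length     = subst (length (s ++ b ∷ []) <_) (trans (sym (length-++ (a ∷ r))) (cong length uv≡))
                         (ℕₚ.m<n+m _ (s≤s z≤n))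
  ; rotation     = split-rotation r s E
  }

Admissible : Word → ℕ → InfWord → InfWord → Set
Admissible w k x y = Σ ℤ λ p →
  (posMod w p ≢ 0 × Fact-ba (periodic w) p x y) ⊎ (posMod w p ≢ k × Fact-ab (periodic w) p x y)

module _ {θ k} (C : Christoffel θ k) where
  open Christoffel C
  open ≡-Reasoning

  private
    W Z : Word
    W = enclose a θ b
    Z = enclose b θ a

    mirror : ∀ p i → periodic Z (- p + + i) ≡ periodic W (p - + suc i)
    mirror p i = begin
      periodic Z (- p + + i)           ≡⟨ cong (λ w → periodic w (- p + + i)) (enclose-reverse palindrome) ⟨
      periodic (reverse W) (- p + + i) ≡⟨ periodic-reverse W (- p + + i) ⟩
      periodic W (- (- p + + i) - + 1) ≡⟨ cong (periodic W) (flip p (+ i)) ⟩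
      periodic W (p - + suc i)         ∎
      where
      flip : ∀ P I → - (- P + I) - + 1 ≡ P - (+ 1 + I)
      flip = solve-∀

    mirror₀ : ∀ p → periodic Z (- p) ≡ periodic W (p - + 1)
    mirror₀ p = trans (cong (periodic Z) (sym (ℤₚ.+-identityʳ (- p)))) (mirror p 0)

    off-boundary : ∀ p {r} z → posMod W p ≢ r → r < length W → z ≡ p - + r ⊎ z ≡ + r - p →
      ¬ Multiple (length W) z
    off-boundary p _ p≢r r<n z≡ z∈nℤ = p≢r (posMod-of-offset W {p} r<n z≡ z∈nℤ)

    toZ : ∀ {z} → ¬ Multiple (length W) z → ¬ Multiple (length Z) z
    toZ {z} = subst (λ n → ¬ Multiple n z) (enclose-length θ a b b a)

  -- y^T b | a x: x is read in aθb from p and y in bθa from -p.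
  -- x^T a | b y: x is read in aθb from k - p and y in bθa from p - k.
  diverge : ∀ {x y} → Admissible W k x y → DivergesAfterLCP a b x θ × DivergesAfterLCP b a y θ
  diverge (p , inj₁ (p≢0 , Wp-1≡b , Wp≡a , x≡ , y≡)) =
    lyndon-reading a≢b {θ} lower-lyndon
      (off-boundary p p p≢0 (s≤s z≤n) (inj₁ (sym (ℤₚ.+-identityʳ p)))) Wp≡a x≡ ,
    lyndon-reading b≢a {θ} upper-lyndon
      (toZ (off-boundary p (- p) p≢0 (s≤s z≤n) (inj₂ (sym (ℤₚ.+-identityˡ (- p))))))
      (trans (mirror₀ p) Wp-1≡b) (λ j → trans (y≡ j) (sym (mirror p (suc j))))
  diverge {x} {y} (p , inj₂ (p≢k , Wp-1≡a , Wp≡b , x≡ , y≡)) =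
    lyndon-reading a≢b {θ} lower-lyndon
      (off-boundary p (+ k - p) p≢k k<length (inj₂ refl)) start-x read-x ,
    lyndon-reading b≢a {θ} upper-lyndon
      (toZ (off-boundary p (p - + k) p≢k k<length (inj₁ refl))) start-y read-y
    where
    swap : ∀ P J K → - P + J + K ≡ K - P + J
    swap = solve-∀
    cancel : ∀ P K → P - K + K ≡ P
    cancel = solve-∀
    shuffle : ∀ P K J → P + J ≡ P - K + J + K
    shuffle = solve-∀
    start-x : periodic W (+ k - p) ≡ a
    start-x = begin
      periodic W (+ k - p)   ≡⟨ cong (periodic W) (ℤₚ.+-comm (+ k) (- p)) ⟩
      periodic W (- p + + k) ≡⟨ rotation (- p) ⟨
      periodic Z (- p)       ≡⟨ mirror₀ p ⟩
      periodic W (p - + 1)   ≡⟨ Wp-1≡a ⟩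
      a                      ∎
    read-x : ∀ j → x j ≡ periodic W (+ k - p + + suc j)
    read-x j = begin
      x j                              ≡⟨ x≡ j ⟩
      periodic W (p - + suc (suc j))   ≡⟨ mirror p (suc j) ⟨
      periodic Z (- p + + suc j)       ≡⟨ rotation (- p + + suc j) ⟩
      periodic W (- p + + suc j + + k) ≡⟨ cong (periodic W) (swap p (+ suc j) (+ k)) ⟩
      periodic W (+ k - p + + suc j)   ∎
    start-y : periodic Z (p - + k) ≡ b
    start-y = begin
      periodic Z (p - + k)       ≡⟨ rotation (p - + k) ⟩
      periodic W (p - + k + + k) ≡⟨ cong (periodic W) (cancel p (+ k)) ⟩
      periodic W p               ≡⟨ Wp≡b ⟩
      b                          ∎
    read-y : ∀ j → y j ≡ periodic Z (p - + k + + suc j)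
    read-y j = begin
      y j                                  ≡⟨ y≡ j ⟩
      periodic W (p + + suc j)             ≡⟨ cong (periodic W) (shuffle p (+ k) (+ suc j)) ⟩
      periodic W (p - + k + + suc j + + k) ≡⟨ rotation (p - + k + + suc j) ⟨
      periodic Z (p - + k + + suc j)       ∎

lemma4p2 : (u v : Word) → Pbar u v → u ++ v ≢ a ∷ b ∷ [] →
    (θ : Word) → u ++ v ≡ a ∷ (θ ++ b ∷ []) →
    (x y : InfWord) → AdmissibleFact u v x y →
    ((θ₁ : Word) → IsLCP x θ θ₁ →
      PrefixInf (θ₁ ++ b ∷ []) x × Prefix (θ₁ ++ a ∷ []) θ)
    × ((θ₂ : Word) → IsLCP y θ θ₂ →
      PrefixInf (θ₂ ++ a ∷ []) y × Prefix (θ₂ ++ b ∷ []) θ)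
lemma4p2 u v uv∈P̄ _ θ uv≡aθb x y adm =
  diverge (pbar-christoffel uv∈P̄ uv≡aθb) (subst (λ w → Admissible w (length v) x y) uv≡aθb adm)
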